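{- Let $k\ge2$ be an integer. The polynomial $P(x)\in\mathbb{Q}[x]$ divides $x^kP(x+1)+(x-1)^kP(x-1)$ in $\mathbb{Q}[x]$ in each of the following cases: (1) $k\equiv0\pmod 2$ and $P(x)=2x-1$; (2) $k\equiv-1\pmod 3$ and $P(x)=3x^2-3x+1$; (3) $k\equiv-1\pmod 4$ and $P(x)=2x^2-2x+1$; (4) $k\equiv-1\pmod 6$ and $P(x)=x^2-x+1$; (5) $k=5$ and $P(x)=5x^4-10x^3+19x^2-14x+4$. -}

module Defs where

open import Data.Nat using (ℕ; zero; suc)
open import Data.Integer using (ℤ; +_; -[1+_])
open import Data.Rational using (ℚ; 0ℚ; 1ℚ; _+_; _*_; -_; _/_)
open import Data.List using (List; []; _∷_)
open import Data.Product using (∃)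
open import Relation.Binary.PropositionalEquality using (_≡_)

-- Univariate polynomials over ℚ as coefficient lists, lowest degree first:
-- a₀ ∷ a₁ ∷ … ∷ aₙ ∷ []  represents  a₀ + a₁ x + … + aₙ xⁿ.
-- Trailing zeros are allowed; equality of polynomials is coefficientwise.
Poly : Set
Poly = List ℚ

coeff : Poly → ℕ → ℚ
coeff []       _       = 0ℚ
coeff (a ∷ p)  zero    = a
coeff (a ∷ p)  (suc n) = coeff p n

infix 4 _≈ₚ_
_≈ₚ_ : Poly → Poly → Set
p ≈ₚ q = ∀ n → coeff p n ≡ coeff q n

infixl 6 _+ₚ_
_+ₚ_ : Poly → Poly → Poly
[]      +ₚ q       = q
(a ∷ p) +ₚ []      = a ∷ p
(a ∷ p) +ₚ (b ∷ q) = (a + b) ∷ (p +ₚ q)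

_·ₚ_ : ℚ → Poly → Poly
c ·ₚ []      = []
c ·ₚ (a ∷ p) = (c * a) ∷ (c ·ₚ p)

shiftₚ : Poly → Poly
shiftₚ p = 0ℚ ∷ p

infixl 7 _*ₚ_
_*ₚ_ : Poly → Poly → Poly
[]      *ₚ q = []
(a ∷ p) *ₚ q = (a ·ₚ q) +ₚ shiftₚ (p *ₚ q)

xPlus : ℚ → Poly
xPlus c = c ∷ 1ℚ ∷ []

X : Poly
X = xPlus 0ℚ

infixr 8 _^ₚ_
_^ₚ_ : Poly → ℕ → Poly
p ^ₚ zero  = 1ℚ ∷ []
p ^ₚ suc n = p *ₚ (p ^ₚ n)

_∘ₚ_ : Poly → Poly → Poly
[]      ∘ₚ q = []
(a ∷ p) ∘ₚ q = (a ∷ []) +ₚ (q *ₚ (p ∘ₚ q))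

infix 4 _∣ₚ_
_∣ₚ_ : Poly → Poly → Set
p ∣ₚ f = ∃ λ q → f ≈ₚ p *ₚ q

ℤtoℚ : ℤ → ℚ
ℤtoℚ z = z / 1

target : ℕ → Poly → Poly
target k P = (X ^ₚ k) *ₚ (P ∘ₚ xPlus 1ℚ) +ₚ (xPlus (- 1ℚ) ^ₚ k) *ₚ (P ∘ₚ xPlus (- 1ℚ))

P₁ P₂ P₃ P₄ P₅ : Poly
P₁ = ℤtoℚ -[1+ 0 ] ∷ ℤtoℚ (+ 2) ∷ []
P₂ = ℤtoℚ (+ 1) ∷ ℤtoℚ -[1+ 2 ] ∷ ℤtoℚ (+ 3) ∷ []
P₃ = ℤtoℚ (+ 1) ∷ ℤtoℚ -[1+ 1 ] ∷ ℤtoℚ (+ 2) ∷ []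
P₄ = ℤtoℚ (+ 1) ∷ ℤtoℚ -[1+ 0 ] ∷ ℤtoℚ (+ 1) ∷ []
P₅ = ℤtoℚ (+ 4) ∷ ℤtoℚ -[1+ 13 ] ∷ ℤtoℚ (+ 19) ∷ ℤtoℚ -[1+ 9 ] ∷ ℤtoℚ (+ 5) ∷ []

-- If P divides x^m − (x−1)^m, then x^(m+k) P(x+1) + (x−1)^(m+k) P(x−1) is congruent
-- modulo P to (x−1)^m (x^k P(x+1) + (x−1)^k P(x−1)), so divisibility for k implies
-- divisibility for m + k. For each of the first four polynomials one checks that
-- P divides x^m − (x−1)^m for m = 2, 3, 4, 6 respectively, and that P divides the
-- target for the least admissible residue (k = 0, 2, 3, 5); the case k = 5 of the
-- quartic is a single computation.
module Submission where

open import Defs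
open import Data.Nat using (ℕ; _≤_; _%_; suc)
open import Data.Product using (_×_)
open import Relation.Binary.PropositionalEquality using (_≡_)

import Data.Nat as ℕ
open import Data.Nat using (zero; _/_; NonZero)
open import Data.Nat.Properties using (+-comm; +-assoc)
open import Data.Nat.DivMod using (m≡m%n+[m/n]*n)
open import Data.Integer using (+_; -[1+_])
open import Data.Rational using (0ℚ; 1ℚ; _+_; _*_; -_)
open import Data.Rational.Properties as ℚ using (_≟_)
open import Data.Bool using (Bool; true; false; T)
open import Data.List using ([]; _∷_)
open import Data.Product using (_,_; ∃)
open import Level using (0ℓ)
open import Relation.Nullary using (yes; no)
open import Relation.Binary.Bundles using (Setoid)
open import Relation.Binary.Structures using (IsEquivalence)
open import Relation.Binary.PropositionalEquality using (refl; sym; trans; cong; cong₂; subst)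
open import Algebra.Bundles using (CommutativeSemigroup)
open import Algebra.Structures using (IsCommutativeSemigroup)
import Relation.Binary.Reasoning.Setoid as SetoidReasoning

-- _≈ₚ_ unfolds to a Π-type, from which Agda cannot infer the two polynomials;
-- wrapping it in a record makes them inferable.
infix 4 _≋_
record _≋_ (p q : Poly) : Set where
  constructor ⟪_⟫
  field coeff-≡ : p ≈ₚ q
open _≋_

≋-isEquivalence : IsEquivalence _≋_
≋-isEquivalence = record
  { refl  = ⟪ (λ _ → refl) ⟫
  ; sym   = λ e → ⟪ (λ n → sym (coeff-≡ e n)) ⟫
  ; trans = λ e f → ⟪ (λ n → trans (coeff-≡ e n) (coeff-≡ f n)) ⟫
  }

≋-setoid : Setoid 0ℓ 0ℓ
≋-setoid = record { isEquivalence = ≋-isEquivalence }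

open Setoid ≋-setoid using () renaming (refl to ≋-refl; sym to ≋-sym; trans to ≋-trans)

module ≋-Reasoning = SetoidReasoning ≋-setoid

∷-cong : ∀ {a b p q} → a ≡ b → p ≋ q → a ∷ p ≋ b ∷ q
∷-cong a≡b p≋q = ⟪ (λ { zero → a≡b ; (suc n) → coeff-≡ p≋q n }) ⟫

∷-≋-[] : ∀ {a p} → a ≡ 0ℚ → p ≋ [] → a ∷ p ≋ []
∷-≋-[] a≡0 p≋[] = ⟪ (λ { zero → a≡0 ; (suc n) → coeff-≡ p≋[] n }) ⟫

coeff-+ₚ : ∀ p q n → coeff (p +ₚ q) n ≡ coeff p n + coeff q n
coeff-+ₚ []      q       n       = sym (ℚ.+-identityˡ _)
coeff-+ₚ (a ∷ p) []      n       = sym (ℚ.+-identityʳ _)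
coeff-+ₚ (a ∷ p) (b ∷ q) zero    = refl
coeff-+ₚ (a ∷ p) (b ∷ q) (suc n) = coeff-+ₚ p q n

coeff-·ₚ : ∀ c p n → coeff (c ·ₚ p) n ≡ c * coeff p n
coeff-·ₚ c []      n       = sym (ℚ.*-zeroʳ c)
coeff-·ₚ c (a ∷ p) zero    = refl
coeff-·ₚ c (a ∷ p) (suc n) = coeff-·ₚ c p n

+ₚ-cong : ∀ {p p′ q q′} → p ≋ p′ → q ≋ q′ → p +ₚ q ≋ p′ +ₚ q′
+ₚ-cong {p} {p′} {q} {q′} e f = ⟪ (λ n →
  trans (coeff-+ₚ p q n)
        (trans (cong₂ _+_ (coeff-≡ e n) (coeff-≡ f n)) (sym (coeff-+ₚ p′ q′ n)))) ⟫

+ₚ-identityʳ : ∀ p → p +ₚ [] ≋ p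
+ₚ-identityʳ []      = ≋-refl
+ₚ-identityʳ (_ ∷ _) = ≋-refl

+ₚ-comm : ∀ p q → p +ₚ q ≋ q +ₚ p
+ₚ-comm []      q       = ≋-sym (+ₚ-identityʳ q)
+ₚ-comm (a ∷ p) []      = ≋-refl
+ₚ-comm (a ∷ p) (b ∷ q) = ∷-cong (ℚ.+-comm a b) (+ₚ-comm p q)

+ₚ-assoc : ∀ p q r → (p +ₚ q) +ₚ r ≋ p +ₚ (q +ₚ r)
+ₚ-assoc []      q       r       = ≋-refl
+ₚ-assoc (a ∷ p) []      r       = ≋-refl
+ₚ-assoc (a ∷ p) (b ∷ q) []      = ≋-refl
+ₚ-assoc (a ∷ p) (b ∷ q) (c ∷ r) = ∷-cong (ℚ.+-assoc a b c) (+ₚ-assoc p q r)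

+ₚ-isCommutativeSemigroup : IsCommutativeSemigroup _≋_ _+ₚ_
+ₚ-isCommutativeSemigroup = record
  { isSemigroup = record
    { isMagma = record { isEquivalence = ≋-isEquivalence ; ∙-cong = +ₚ-cong }
    ; assoc   = +ₚ-assoc
    }
  ; comm = +ₚ-comm
  }

+ₚ-commutativeSemigroup : CommutativeSemigroup 0ℓ 0ℓ
+ₚ-commutativeSemigroup = record { isCommutativeSemigroup = +ₚ-isCommutativeSemigroup }

open import Algebra.Properties.CommutativeSemigroup +ₚ-commutativeSemigroup
  using (interchange; xy∙z≈xz∙y)

·ₚ-cong : ∀ c {p p′} → p ≋ p′ → c ·ₚ p ≋ c ·ₚ p′
·ₚ-cong c {p} {p′} e = ⟪ (λ n →
  trans (coeff-·ₚ c p n) (trans (cong (c *_) (coeff-≡ e n)) (sym (coeff-·ₚ c p′ n)))) ⟫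

·ₚ-distribˡ : ∀ c p q → c ·ₚ (p +ₚ q) ≋ c ·ₚ p +ₚ c ·ₚ q
·ₚ-distribˡ c []      q       = ≋-refl
·ₚ-distribˡ c (a ∷ p) []      = ≋-refl
·ₚ-distribˡ c (a ∷ p) (b ∷ q) = ∷-cong (ℚ.*-distribˡ-+ c a b) (·ₚ-distribˡ c p q)

·ₚ-distribʳ : ∀ a b p → (a + b) ·ₚ p ≋ a ·ₚ p +ₚ b ·ₚ p
·ₚ-distribʳ a b []      = ≋-refl
·ₚ-distribʳ a b (c ∷ p) = ∷-cong (ℚ.*-distribʳ-+ c a b) (·ₚ-distribʳ a b p)

·ₚ-assoc : ∀ c d p → c ·ₚ (d ·ₚ p) ≋ (c * d) ·ₚ p
·ₚ-assoc c d []      = ≋-refl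
·ₚ-assoc c d (a ∷ p) = ∷-cong (sym (ℚ.*-assoc c d a)) (·ₚ-assoc c d p)

·ₚ-zeroˡ : ∀ p → 0ℚ ·ₚ p ≋ []
·ₚ-zeroˡ []      = ≋-refl
·ₚ-zeroˡ (a ∷ p) = ∷-≋-[] (ℚ.*-zeroˡ a) (·ₚ-zeroˡ p)

·ₚ-identityˡ : ∀ p → 1ℚ ·ₚ p ≋ p
·ₚ-identityˡ []      = ≋-refl
·ₚ-identityˡ (a ∷ p) = ∷-cong (ℚ.*-identityˡ a) (·ₚ-identityˡ p)

·ₚ-shiftₚ : ∀ c p → c ·ₚ shiftₚ p ≋ shiftₚ (c ·ₚ p)
·ₚ-shiftₚ c p = ∷-cong (ℚ.*-zeroʳ c) ≋-refl

shiftₚ-cong : ∀ {p p′} → p ≋ p′ → shiftₚ p ≋ shiftₚ p′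
shiftₚ-cong = ∷-cong refl

shiftₚ-+ₚ : ∀ p q → shiftₚ (p +ₚ q) ≋ shiftₚ p +ₚ shiftₚ q
shiftₚ-+ₚ p q = ∷-cong (sym (ℚ.+-identityˡ 0ℚ)) ≋-refl

∷-≋-+ₚ-shiftₚ : ∀ a p → a ∷ p ≋ (a ∷ []) +ₚ shiftₚ p
∷-≋-+ₚ-shiftₚ a p = ∷-cong (sym (ℚ.+-identityʳ a)) ≋-refl

*ₚ-zeroʳ : ∀ p → p *ₚ [] ≋ []
*ₚ-zeroʳ []      = ≋-refl
*ₚ-zeroʳ (a ∷ p) = ∷-≋-[] refl (*ₚ-zeroʳ p)

*ₚ-congʳ : ∀ p {q q′} → q ≋ q′ → p *ₚ q ≋ p *ₚ q′
*ₚ-congʳ []      e = ≋-refl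
*ₚ-congʳ (a ∷ p) e = +ₚ-cong (·ₚ-cong a e) (shiftₚ-cong (*ₚ-congʳ p e))

*ₚ-distribʳ : ∀ p p′ q → (p +ₚ p′) *ₚ q ≋ p *ₚ q +ₚ p′ *ₚ q
*ₚ-distribʳ []      p′       q = ≋-refl
*ₚ-distribʳ (a ∷ p) []       q = ≋-sym (+ₚ-identityʳ _)
*ₚ-distribʳ (a ∷ p) (b ∷ p′) q = begin
  (a + b) ·ₚ q +ₚ shiftₚ ((p +ₚ p′) *ₚ q)
    ≈⟨ +ₚ-cong (·ₚ-distribʳ a b q) (shiftₚ-cong (*ₚ-distribʳ p p′ q)) ⟩
  (a ·ₚ q +ₚ b ·ₚ q) +ₚ shiftₚ (p *ₚ q +ₚ p′ *ₚ q)
    ≈⟨ +ₚ-cong ≋-refl (shiftₚ-+ₚ (p *ₚ q) (p′ *ₚ q)) ⟩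
  (a ·ₚ q +ₚ b ·ₚ q) +ₚ (shiftₚ (p *ₚ q) +ₚ shiftₚ (p′ *ₚ q))
    ≈⟨ interchange (a ·ₚ q) (b ·ₚ q) _ _ ⟩
  (a ·ₚ q +ₚ shiftₚ (p *ₚ q)) +ₚ (b ·ₚ q +ₚ shiftₚ (p′ *ₚ q)) ∎
  where open ≋-Reasoning

*ₚ-distribˡ : ∀ p q q′ → p *ₚ (q +ₚ q′) ≋ p *ₚ q +ₚ p *ₚ q′
*ₚ-distribˡ []      q q′ = ≋-refl
*ₚ-distribˡ (a ∷ p) q q′ = begin
  a ·ₚ (q +ₚ q′) +ₚ shiftₚ (p *ₚ (q +ₚ q′))
    ≈⟨ +ₚ-cong (·ₚ-distribˡ a q q′) (shiftₚ-cong (*ₚ-distribˡ p q q′)) ⟩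
  (a ·ₚ q +ₚ a ·ₚ q′) +ₚ shiftₚ (p *ₚ q +ₚ p *ₚ q′)
    ≈⟨ +ₚ-cong ≋-refl (shiftₚ-+ₚ (p *ₚ q) (p *ₚ q′)) ⟩
  (a ·ₚ q +ₚ a ·ₚ q′) +ₚ (shiftₚ (p *ₚ q) +ₚ shiftₚ (p *ₚ q′))
    ≈⟨ interchange (a ·ₚ q) (a ·ₚ q′) _ _ ⟩
  (a ·ₚ q +ₚ shiftₚ (p *ₚ q)) +ₚ (a ·ₚ q′ +ₚ shiftₚ (p *ₚ q′)) ∎
  where open ≋-Reasoning

·ₚ-*ₚ : ∀ c p q → (c ·ₚ p) *ₚ q ≋ c ·ₚ (p *ₚ q)
·ₚ-*ₚ c []      q = ≋-refl
·ₚ-*ₚ c (a ∷ p) q = begin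
  (c * a) ·ₚ q +ₚ shiftₚ ((c ·ₚ p) *ₚ q)
    ≈⟨ +ₚ-cong (≋-sym (·ₚ-assoc c a q)) (shiftₚ-cong (·ₚ-*ₚ c p q)) ⟩
  c ·ₚ (a ·ₚ q) +ₚ shiftₚ (c ·ₚ (p *ₚ q))
    ≈⟨ +ₚ-cong ≋-refl (·ₚ-shiftₚ c (p *ₚ q)) ⟨
  c ·ₚ (a ·ₚ q) +ₚ c ·ₚ shiftₚ (p *ₚ q)
    ≈⟨ ·ₚ-distribˡ c (a ·ₚ q) (shiftₚ (p *ₚ q)) ⟨
  c ·ₚ (a ·ₚ q +ₚ shiftₚ (p *ₚ q)) ∎
  where open ≋-Reasoning

shiftₚ-*ₚ : ∀ p q → shiftₚ p *ₚ q ≋ shiftₚ (p *ₚ q)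
shiftₚ-*ₚ p q = +ₚ-cong (·ₚ-zeroˡ q) ≋-refl

*ₚ-shiftₚ : ∀ p q → p *ₚ shiftₚ q ≋ shiftₚ (p *ₚ q)
*ₚ-shiftₚ []      q = ≋-sym (∷-≋-[] refl ≋-refl)
*ₚ-shiftₚ (a ∷ p) q =
  ∷-cong (trans (ℚ.+-identityʳ _) (ℚ.*-zeroʳ a)) (+ₚ-cong ≋-refl (*ₚ-shiftₚ p q))

*ₚ-constʳ : ∀ a q → q *ₚ (a ∷ []) ≋ a ·ₚ q
*ₚ-constʳ a []      = ≋-refl
*ₚ-constʳ a (b ∷ q) = ∷-cong (trans (ℚ.+-identityʳ _) (ℚ.*-comm b a)) (*ₚ-constʳ a q)

*ₚ-comm : ∀ p q → p *ₚ q ≋ q *ₚ p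
*ₚ-comm []      q = ≋-sym (*ₚ-zeroʳ q)
*ₚ-comm (a ∷ p) q = begin
  a ·ₚ q +ₚ shiftₚ (p *ₚ q)
    ≈⟨ +ₚ-cong (*ₚ-constʳ a q) (≋-trans (*ₚ-shiftₚ q p) (shiftₚ-cong (*ₚ-comm q p))) ⟨
  q *ₚ (a ∷ []) +ₚ q *ₚ shiftₚ p
    ≈⟨ *ₚ-distribˡ q (a ∷ []) (shiftₚ p) ⟨
  q *ₚ ((a ∷ []) +ₚ shiftₚ p)
    ≈⟨ *ₚ-congʳ q (∷-≋-+ₚ-shiftₚ a p) ⟨
  q *ₚ (a ∷ p) ∎
  where open ≋-Reasoning

*ₚ-congˡ : ∀ {p p′} q → p ≋ p′ → p *ₚ q ≋ p′ *ₚ q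
*ₚ-congˡ {p} {p′} q e = ≋-trans (*ₚ-comm p q) (≋-trans (*ₚ-congʳ q e) (*ₚ-comm q p′))

*ₚ-assoc : ∀ p q r → (p *ₚ q) *ₚ r ≋ p *ₚ (q *ₚ r)
*ₚ-assoc []      q r = ≋-refl
*ₚ-assoc (a ∷ p) q r = begin
  (a ·ₚ q +ₚ shiftₚ (p *ₚ q)) *ₚ r
    ≈⟨ *ₚ-distribʳ (a ·ₚ q) (shiftₚ (p *ₚ q)) r ⟩
  (a ·ₚ q) *ₚ r +ₚ shiftₚ (p *ₚ q) *ₚ r
    ≈⟨ +ₚ-cong (·ₚ-*ₚ a q r) (≋-trans (shiftₚ-*ₚ (p *ₚ q) r) (shiftₚ-cong (*ₚ-assoc p q r))) ⟩
  a ·ₚ (q *ₚ r) +ₚ shiftₚ (p *ₚ (q *ₚ r)) ∎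
  where open ≋-Reasoning

*ₚ-identityˡ : ∀ p → (1ℚ ∷ []) *ₚ p ≋ p
*ₚ-identityˡ p = ≋-trans (+ₚ-cong (·ₚ-identityˡ p) (∷-≋-[] refl ≋-refl)) (+ₚ-identityʳ p)

^ₚ-+ : ∀ f m k → f ^ₚ (m ℕ.+ k) ≋ f ^ₚ m *ₚ f ^ₚ k
^ₚ-+ f zero    k = ≋-sym (*ₚ-identityˡ (f ^ₚ k))
^ₚ-+ f (suc m) k = ≋-trans (*ₚ-congʳ f (^ₚ-+ f m k)) (≋-sym (*ₚ-assoc f (f ^ₚ m) (f ^ₚ k)))

∣ₚ-respʳ : ∀ P {f g} → f ≋ g → P ∣ₚ f → P ∣ₚ g
∣ₚ-respʳ P {f} f≋g (q , f≈Pq) = q , coeff-≡ (≋-trans (≋-sym f≋g) (⟪_⟫ {f} {P *ₚ q} f≈Pq))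

∣ₚ-+ₚ : ∀ P f g → P ∣ₚ f → P ∣ₚ g → P ∣ₚ f +ₚ g
∣ₚ-+ₚ P f g (q , f≈Pq) (r , g≈Pr) = q +ₚ r , coeff-≡ (begin
  f +ₚ g                ≈⟨ +ₚ-cong (⟪_⟫ {f} {P *ₚ q} f≈Pq) (⟪_⟫ {g} {P *ₚ r} g≈Pr) ⟩
  P *ₚ q +ₚ P *ₚ r      ≈⟨ *ₚ-distribˡ P q r ⟨
  P *ₚ (q +ₚ r)         ∎)
  where open ≋-Reasoning

∣ₚ-*ₚˡ : ∀ P f g → P ∣ₚ f → P ∣ₚ g *ₚ f
∣ₚ-*ₚˡ P f g (q , f≈Pq) = g *ₚ q , coeff-≡ (begin
  g *ₚ f        ≈⟨ *ₚ-congʳ g (⟪_⟫ {f} {P *ₚ q} f≈Pq) ⟩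
  g *ₚ (P *ₚ q) ≈⟨ *ₚ-assoc g P q ⟨
  (g *ₚ P) *ₚ q ≈⟨ *ₚ-congˡ q (*ₚ-comm g P) ⟩
  (P *ₚ g) *ₚ q ≈⟨ *ₚ-assoc P g q ⟩
  P *ₚ (g *ₚ q) ∎)
  where open ≋-Reasoning

infix 4 _≡ₚ_[mod_]
_≡ₚ_[mod_] : Poly → Poly → Poly → Set
f ≡ₚ g [mod P ] = ∃ λ D → f ≋ g +ₚ P *ₚ D

X-1 : Poly
X-1 = xPlus (- 1ℚ)

∣ₚ-target-+ : ∀ P m k → X ^ₚ m ≡ₚ X-1 ^ₚ m [mod P ] →
              P ∣ₚ target k P → P ∣ₚ target (m ℕ.+ k) P
∣ₚ-target-+ P m k (D , Xᵐ≋) P∣target =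
  ∣ₚ-respʳ P (≋-sym decomposition)
    (∣ₚ-+ₚ P (X-1 ^ₚ m *ₚ target k P) (P *ₚ (D *ₚ t))
      (∣ₚ-*ₚˡ P (target k P) (X-1 ^ₚ m) P∣target) (D *ₚ t , λ _ → refl))
  where
  A B t s : Poly
  A = P ∘ₚ xPlus 1ℚ
  B = P ∘ₚ X-1
  t = X ^ₚ k *ₚ A
  s = X-1 ^ₚ k *ₚ B

  decomposition : target (m ℕ.+ k) P ≋ X-1 ^ₚ m *ₚ target k P +ₚ P *ₚ (D *ₚ t)
  decomposition = begin
    X ^ₚ (m ℕ.+ k) *ₚ A +ₚ X-1 ^ₚ (m ℕ.+ k) *ₚ B
      ≈⟨ +ₚ-cong (*ₚ-congˡ A (^ₚ-+ X m k)) (*ₚ-congˡ B (^ₚ-+ X-1 m k)) ⟩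
    (X ^ₚ m *ₚ X ^ₚ k) *ₚ A +ₚ (X-1 ^ₚ m *ₚ X-1 ^ₚ k) *ₚ B
      ≈⟨ +ₚ-cong (*ₚ-assoc (X ^ₚ m) (X ^ₚ k) A) (*ₚ-assoc (X-1 ^ₚ m) (X-1 ^ₚ k) B) ⟩
    X ^ₚ m *ₚ t +ₚ X-1 ^ₚ m *ₚ s
      ≈⟨ +ₚ-cong (*ₚ-congˡ t Xᵐ≋) ≋-refl ⟩
    (X-1 ^ₚ m +ₚ P *ₚ D) *ₚ t +ₚ X-1 ^ₚ m *ₚ s
      ≈⟨ +ₚ-cong (*ₚ-distribʳ (X-1 ^ₚ m) (P *ₚ D) t) ≋-refl ⟩
    (X-1 ^ₚ m *ₚ t +ₚ (P *ₚ D) *ₚ t) +ₚ X-1 ^ₚ m *ₚ s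
      ≈⟨ xy∙z≈xz∙y (X-1 ^ₚ m *ₚ t) ((P *ₚ D) *ₚ t) (X-1 ^ₚ m *ₚ s) ⟩
    (X-1 ^ₚ m *ₚ t +ₚ X-1 ^ₚ m *ₚ s) +ₚ (P *ₚ D) *ₚ t
      ≈⟨ +ₚ-cong (*ₚ-distribˡ (X-1 ^ₚ m) t s) (≋-sym (*ₚ-assoc P D t)) ⟨
    X-1 ^ₚ m *ₚ (t +ₚ s) +ₚ P *ₚ (D *ₚ t) ∎
    where open ≋-Reasoning

∣ₚ-target-+-multiple : ∀ P m r → X ^ₚ m ≡ₚ X-1 ^ₚ m [mod P ] →
                       P ∣ₚ target r P → ∀ j → P ∣ₚ target (j ℕ.* m ℕ.+ r) P
∣ₚ-target-+-multiple P m r period base zero    = base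
∣ₚ-target-+-multiple P m r period base (suc j) =
  subst (λ k → P ∣ₚ target k P) (sym (+-assoc m (j ℕ.* m) r))
        (∣ₚ-target-+ P m (j ℕ.* m ℕ.+ r) period (∣ₚ-target-+-multiple P m r period base j))

∣ₚ-target-mod : ∀ P m r .{{_ : NonZero m}} → X ^ₚ m ≡ₚ X-1 ^ₚ m [mod P ] →
                P ∣ₚ target r P → ∀ k → k % m ≡ r → P ∣ₚ target k P
∣ₚ-target-mod P m r period base k k%m≡r =
  subst (λ k → P ∣ₚ target k P) (sym k≡[k/m]*m+r)
        (∣ₚ-target-+-multiple P m r period base (k / m))
  where
  k≡[k/m]*m+r : k ≡ (k / m) ℕ.* m ℕ.+ r
  k≡[k/m]*m+r = trans (m≡m%n+[m/n]*n k m)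
                      (trans (cong (ℕ._+ (k / m) ℕ.* m) k%m≡r) (+-comm r _))

isZeroₚ : Poly → Bool
isZeroₚ []      = true
isZeroₚ (a ∷ p) with a ≟ 0ℚ
... | yes _ = isZeroₚ p
... | no  _ = false

isZeroₚ-sound : ∀ p → T (isZeroₚ p) → p ≋ []
isZeroₚ-sound []      _ = ≋-refl
isZeroₚ-sound (a ∷ p) h with a ≟ 0ℚ
... | yes a≡0 = ∷-≋-[] a≡0 (isZeroₚ-sound p h)

infix 4 _==ₚ_
_==ₚ_ : Poly → Poly → Bool
[]      ==ₚ q       = isZeroₚ q
(a ∷ p) ==ₚ []      = isZeroₚ (a ∷ p)
(a ∷ p) ==ₚ (b ∷ q) with a ≟ b
... | yes _ = p ==ₚ q
... | no  _ = false

==ₚ-sound : ∀ p q → T (p ==ₚ q) → p ≋ q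
==ₚ-sound []      q       h = ≋-sym (isZeroₚ-sound q h)
==ₚ-sound (a ∷ p) []      h = isZeroₚ-sound (a ∷ p) h
==ₚ-sound (a ∷ p) (b ∷ q) h with a ≟ b
... | yes a≡b = ∷-cong a≡b (==ₚ-sound p q h)

≡ₚ-by-evaluation : ∀ f g P D {_ : T (f ==ₚ g +ₚ P *ₚ D)} → f ≡ₚ g [mod P ]
≡ₚ-by-evaluation f g P D {h} = D , ==ₚ-sound f (g +ₚ P *ₚ D) h

∣ₚ-by-evaluation : ∀ P f Q {_ : T (f ==ₚ P *ₚ Q)} → P ∣ₚ f
∣ₚ-by-evaluation P f Q {h} = Q , coeff-≡ (==ₚ-sound f (P *ₚ Q) h)

-- The quotients D and Q below were found by polynomial long division.
period₁ : X ^ₚ 2 ≡ₚ X-1 ^ₚ 2 [mod P₁ ]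
period₁ = ≡ₚ-by-evaluation (X ^ₚ 2) (X-1 ^ₚ 2) P₁ (ℤtoℚ (+ 1) ∷ [])

period₂ : X ^ₚ 3 ≡ₚ X-1 ^ₚ 3 [mod P₂ ]
period₂ = ≡ₚ-by-evaluation (X ^ₚ 3) (X-1 ^ₚ 3) P₂ (ℤtoℚ (+ 1) ∷ [])

period₃ : X ^ₚ 4 ≡ₚ X-1 ^ₚ 4 [mod P₃ ]
period₃ = ≡ₚ-by-evaluation (X ^ₚ 4) (X-1 ^ₚ 4) P₃
  (ℤtoℚ -[1+ 0 ] ∷ ℤtoℚ (+ 2) ∷ [])

period₄ : X ^ₚ 6 ≡ₚ X-1 ^ₚ 6 [mod P₄ ]
period₄ = ≡ₚ-by-evaluation (X ^ₚ 6) (X-1 ^ₚ 6) P₄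
  (ℤtoℚ -[1+ 0 ] ∷ ℤtoℚ (+ 5) ∷ ℤtoℚ -[1+ 8 ] ∷ ℤtoℚ (+ 6) ∷ [])

base₁ : P₁ ∣ₚ target 0 P₁
base₁ = ∣ₚ-by-evaluation P₁ (target 0 P₁) (ℤtoℚ (+ 2) ∷ [])

base₂ : P₂ ∣ₚ target 2 P₂
base₂ = ∣ₚ-by-evaluation P₂ (target 2 P₂)
  (ℤtoℚ (+ 7) ∷ ℤtoℚ -[1+ 1 ] ∷ ℤtoℚ (+ 2) ∷ [])

base₃ : P₃ ∣ₚ target 3 P₃
base₃ = ∣ₚ-by-evaluation P₃ (target 3 P₃)
  (ℤtoℚ -[1+ 4 ] ∷ ℤtoℚ (+ 11) ∷ ℤtoℚ -[1+ 2 ] ∷ ℤtoℚ (+ 2) ∷ [])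

base₄ : P₄ ∣ₚ target 5 P₄
base₄ = ∣ₚ-by-evaluation P₄ (target 5 P₄)
  (ℤtoℚ -[1+ 2 ] ∷ ℤtoℚ (+ 15) ∷ ℤtoℚ -[1+ 27 ] ∷ ℤtoℚ (+ 22) ∷ ℤtoℚ -[1+ 4 ] ∷ ℤtoℚ (+ 2) ∷ [])

base₅ : P₅ ∣ₚ target 5 P₅
base₅ = ∣ₚ-by-evaluation P₅ (target 5 P₅)
  (ℤtoℚ -[1+ 12 ] ∷ ℤtoℚ (+ 45) ∷ ℤtoℚ -[1+ 57 ] ∷ ℤtoℚ (+ 42) ∷ ℤtoℚ -[1+ 4 ] ∷ ℤtoℚ (+ 2) ∷ [])

mainTheorem3 : (k : ℕ) → 2 ≤ k →
    ((k % 2 ≡ 0) → P₁ ∣ₚ target k P₁)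
    × ((k % 3 ≡ 2) → P₂ ∣ₚ target k P₂)
    × ((k % 4 ≡ 3) → P₃ ∣ₚ target k P₃)
    × ((k % 6 ≡ 5) → P₄ ∣ₚ target k P₄)
    × ((k ≡ 5) → P₅ ∣ₚ target k P₅)
mainTheorem3 k _ =
    ∣ₚ-target-mod P₁ 2 0 period₁ base₁ k
  , ∣ₚ-target-mod P₂ 3 2 period₂ base₂ k
  , ∣ₚ-target-mod P₃ 4 3 period₃ base₃ k
  , ∣ₚ-target-mod P₄ 6 5 period₄ base₄ k
  , λ { refl → base₅ }
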